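{- Let $G$ be a connected graph of order $n\ge 2$ with $V(G)=\{u_1,\ldots,u_n\}$ and let $\mathcal{H}=\{H_1,\ldots,H_n\}$ be a family of $n$ graphs without isolated vertices. Let $k\in\{1,\ldots,\min\{\mathcal{T}(G\circ\mathcal{H}),\mathcal{C}(\mathcal{H})\}\}$. If $\Delta(H_i)-1\le\lfloor k/2\rfloor$ for every $H_i\in\mathcal{H}$, then $(G,\mathcal{H},k)$ satisfies Property $\mathcal{P}_2$.
   Context: Graphs are finite and simple; $\delta,\Delta$ minimum/maximum degree. Lexicographic product $G\circ\mathcal{H}$: vertex set $\bigcup_i\{u_i\}\times V(H_i)$, $(u_i,v)\sim(u_j,w)$ iff $u_iu_j\in E(G)$, or $i=j$ and $vw\in E(H_i)$. For a graph $H$, $S$ is a $k$-adjacency generator if every two distinct $x,y$ satisfy $|((N_H(x)\triangledown N_H(y))\cup\{x,y\})\cap S|\ge k$; a $k$-adjacency basis is one of minimum cardinality. $\mathcal{C}(H)=\min_{x\neq y}|(N_H(x)\triangledown N_H(y))\cup\{x,y\}|$, $\mathcal{C}(\mathcal{H})=\min_i\mathcal{C}(H_i)$. Distinct $x,y\in V(G)$ are true twins if $N[x]=N[y]$, false twins if $N(x)=N(y)$; the relation $N(x)-\{y\}=N(y)-\{x\}$ partitions $V(G)$ into singleton, false twin and true twin classes with unions $S(G),FT(G),TT(G)$; $FT(u_i),TT(u_i)$ is the class of $u_i$. $\mathcal{T}(u_i,\mathcal{H})=|V(H_i)|$ if $u_i\in S(G)$; $=\min\{\delta(H_j)+\delta(H_l)+2: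 u_j,u_l\in FT(u_i), j\neq l\}$ if $u_i\in FT(G)$; $=\min\{|V(H_j)|-\Delta(H_j)+|V(H_l)|-\Delta(H_l): u_j,u_l\in TT(u_i), j\neq l\}$ if $u_i\in TT(G)$; $\mathcal{T}(G\circ\mathcal{H})=\min_{u_i}\mathcal{T}(u_i,\mathcal{H})$. Property $\mathcal{P}_2$ of $(G,\mathcal{H},k)$: for every $u_i\in FT(G)$ with $FT(u_i)=\{u_{i_1},\ldots,u_{i_r}\}$ there exist $k$-adjacency bases $A_{i_1},\ldots,A_{i_r}$ of $H_{i_1},\ldots,H_{i_r}$ such that for all $j\neq l$, all $x\in V(H_{i_j})$, $y\in V(H_{i_l})$: $|(A_{i_j}\cap N_{H_{i_j}}[x])\cup(A_{i_l}\cap N_{H_{i_l}}[y])|\ge k$. -}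

module Defs where

open import Data.Nat using (ℕ; zero; suc; _+_; _∸_; _≤_; _⊓_; _⊔_; _/_)
open import Data.Bool using (Bool; true; false; _xor_; if_then_else_)
open import Data.Bool.Properties using () renaming (_≟_ to _≟ᵇ_)
open import Data.Fin using (Fin) renaming (_≟_ to _≟ᶠ_)
open import Data.Fin.Subset using (Subset; _∩_; _∪_; ⁅_⁆; ∣_∣)
open import Data.Vec using (Vec; tabulate; zipWith)
open import Data.Vec.Properties using (≡-dec)
open import Data.List using (List; []; _∷_; map; foldr; filter; concatMap; length; allFin)
open import Data.Product using (Σ; ∃; _×_; _,_)
open import Relation.Nullary using (¬_; does)
open import Relation.Nullary.Decidable using (¬?)
open import Relation.Binary.PropositionalEquality using (_≡_; _≢_)

record Graph (n : ℕ) : Set where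
  field
    adj    : Fin n → Fin n → Bool
    sym    : ∀ x y → adj x y ≡ adj y x
    irrefl : ∀ x → adj x x ≡ false
open Graph public

module _ {n : ℕ} (H : Graph n) where
  N : Fin n → Subset n
  N x = tabulate (adj H x)

  N[_] : Fin n → Subset n
  N[ x ] = N x ∪ ⁅ x ⁆

  deg : Fin n → ℕ
  deg x = ∣ N x ∣

_▽_ : ∀ {n} → Subset n → Subset n → Subset n
_▽_ = zipWith _xor_

-- minimum / maximum of a list of naturals (minimum of [] is 0; all uses
-- below are on nonempty lists under the hypotheses of the theorem)
minimum : List ℕ → ℕ
minimum []       = 0
minimum (x ∷ xs) = foldr _⊓_ x xs

maximum : List ℕ → ℕ
maximum = foldr _⊔_ 0

distinctPairs : ∀ {n} → List (Fin n) → List (Fin n × Fin n)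
distinctPairs xs =
  concatMap (λ x → map (λ y → (x , y)) (filter (λ y → ¬? (x ≟ᶠ y)) xs)) xs

δ : ∀ {n} → Graph n → ℕ
δ {n} H = minimum (map (deg H) (allFin n))

Δ : ∀ {n} → Graph n → ℕ
Δ {n} H = maximum (map (deg H) (allFin n))

adjSep : ∀ {n} → Graph n → Fin n → Fin n → Subset n
adjSep H x y = (N H x ▽ N H y) ∪ (⁅ x ⁆ ∪ ⁅ y ⁆)

IsAdjGen : ∀ {n} → Graph n → ℕ → Subset n → Set
IsAdjGen H k S = ∀ x y → x ≢ y → k ≤ ∣ adjSep H x y ∩ S ∣

IsAdjBasis : ∀ {n} → Graph n → ℕ → Subset n → Set
IsAdjBasis H k S = IsAdjGen H k S × (∀ S′ → IsAdjGen H k S′ → ∣ S ∣ ≤ ∣ S′ ∣)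

𝒞 : ∀ {n} → Graph n → ℕ
𝒞 {n} H = minimum (map (λ p → ∣ adjSep H (Data.Product.proj₁ p) (Data.Product.proj₂ p) ∣)
                       (distinctPairs (allFin n)))

NoIsolated : ∀ {n} → Graph n → Set
NoIsolated {n} H = ∀ x → ∃ λ (y : Fin n) → adj H x y ≡ true

data Reach {n} (G : Graph n) : Fin n → Fin n → Set where
  here : ∀ {x} → Reach G x x
  step : ∀ {x y z} → adj G x y ≡ true → Reach G y z → Reach G x z

Connected : ∀ {n} → Graph n → Set
Connected {n} G = ∀ (x y : Fin n) → Reach G x y

_≟ˢ_ : ∀ {n} (A B : Subset n) → Relation.Nullary.Dec (A ≡ B)
_≟ˢ_ = ≡-dec _≟ᵇ_

FTclass : ∀ {n} → Graph n → Fin n → List (Fin n)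
FTclass {n} G u = filter (λ v → N G v ≟ˢ N G u) (allFin n)

TTclass : ∀ {n} → Graph n → Fin n → List (Fin n)
TTclass {n} G u = filter (λ v → N[_] G v ≟ˢ N[_] G u) (allFin n)

InFT : ∀ {n} → Graph n → Fin n → Set
InFT {n} G u = ∃ λ (v : Fin n) → v ≢ u × N G v ≡ N G u

module _ {n : ℕ} (G : Graph n) (ord : Fin n → ℕ) (H : (i : Fin n) → Graph (ord i)) where
  𝒯ᵤ : Fin n → ℕ
  𝒯ᵤ u with FTclass G u | TTclass G u
  ... | _ ∷ _ ∷ _ | _ =
    minimum (map (λ p → δ (H (Data.Product.proj₁ p)) + δ (H (Data.Product.proj₂ p)) + 2)
                 (distinctPairs (FTclass G u)))
  ... | _ | _ ∷ _ ∷ _ =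
    minimum (map (λ p → (ord (Data.Product.proj₁ p) ∸ Δ (H (Data.Product.proj₁ p)))
                       + (ord (Data.Product.proj₂ p) ∸ Δ (H (Data.Product.proj₂ p))))
                 (distinctPairs (TTclass G u)))
  ... | _ | _ = ord u

  𝒯 : ℕ
  𝒯 = minimum (map 𝒯ᵤ (allFin n))

  𝒞fam : ℕ
  𝒞fam = minimum (map (λ i → 𝒞 (H i)) (allFin n))

  -- Property 𝒫₂ of (G, 𝓗, k).  The vertex sets of distinct H_j, H_l are
  -- disjoint in G ∘ 𝓗, so |(A_j ∩ N[x]) ∪ (A_l ∩ N[y])| is the sum of the
  -- two cardinalities.
  Property𝒫₂ : ℕ → Set
  Property𝒫₂ k =
    ∀ (u : Fin n) → InFT G u →
    Σ ((i : Fin n) → Subset (ord i)) λ A →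
      (∀ i → N G i ≡ N G u → IsAdjBasis (H i) k (A i)) ×
      (∀ j l → N G j ≡ N G u → N G l ≡ N G u → j ≢ l →
         ∀ (x : Fin (ord j)) (y : Fin (ord l)) →
           k ≤ ∣ A j ∩ N[_] (H j) x ∣ + ∣ A l ∩ N[_] (H l) y ∣)

-- Let S be a k-adjacency generator of H and y a neighbour of x.  A vertex of S separating x
-- from y lies in N[x] or is a neighbour of y other than x, and there are at most
-- Δ(H) − 1 ≤ ⌊k/2⌋ of the latter; hence |S ∩ N[x]| ≥ k − ⌊k/2⌋ = ⌈k/2⌉, and two such
-- intersections always have at least k elements together.  Bases exist because k ≤ 𝒞(H)
-- makes V(H) itself a k-adjacency generator.

module Submission where

open import Defs hiding (sym)
open import Data.Nat using (ℕ; _≤_; _∸_; _/_; _⊓_)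
open import Data.Fin using (Fin)

open import Data.Bool using (true)
open import Data.Empty using (⊥-elim)
open import Data.Fin using (zero; suc) renaming (_≟_ to _≟ᶠ_)
open import Data.Fin.Properties using (all?)
open import Data.Fin.Subset using (Subset; _∈_; _∉_; _⊆_; _∩_; _∪_; _-_; ⁅_⁆; ∣_∣; inside; outside; ⊤)
open import Data.Fin.Subset.Properties
  using (_∈?_; anySubset?; ∣p∣≤∣x∷p∣; p⊆q⇒∣p∣≤∣q∣; x∈p⇒∣p-x∣<∣p∣; x∈p∧x≢y⇒x∈p-y;
         x∈⁅x⁆; x∈⁅y⁆⇒x≡y; x∈p∩q⁺; x∈p∩q⁻; x∈p∪q⁺; x∈p∪q⁻; p⊆p∪q; q⊆p∪q; ∩-identityʳ)
open import Data.List using (List; _∷_; map; filter; allFin)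
open import Data.List.Properties using (foldr-preservesᵒ)
open import Data.List.Membership.Propositional using () renaming (_∈_ to _∈ˡ_)
open import Data.List.Membership.Propositional.Properties using (∈-map⁺; ∈-allFin; ∈-filter⁺; ∈-concatMap⁺)
open import Data.List.Relation.Unary.Any as Any using (here; there)
open import Data.Nat using (_+_; _<_; _<?_; _≤?_; s≤s; z≤n)
open import Data.Nat.Properties
  using (≤-refl; ≤-reflexive; ≤-trans; <-≤-trans; ≮⇒≥; module ≤-Reasoning;
         +-suc; +-identityʳ; *-comm; +-monoʳ-≤; +-monoˡ-≤; +-mono-≤;
         m≤n⇒m⊓o≤n; m≤n⇒o⊓m≤n; m≤n⇒m≤n⊔o; m≤n⇒m≤o⊔n; m≤n⊓o⇒m≤o;
         suc[m]≤n⇒m≤pred[n]; pred[m∸n]≡m∸[1+n]; m≤n+o⇒m∸n≤o; m∸n+n≡m; m+n≤o⇒m≤o; m+n≤o⇒m≤o∸n)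
open import Data.Nat.DivMod using (m/n*n≤m)
open import Data.Nat.Induction using (<-wellFounded)
open import Data.Product using (∃; ∃-syntax; _×_; _,_; proj₁; proj₂)
open import Data.Sum using (_⊎_; inj₁; inj₂; [_,_]′)
open import Data.Vec using ([]; _∷_; here; there)
open import Data.Vec.Properties using (lookup∘tabulate; lookup⇒[]=; []=⇒lookup)
open import Function using (_∘_; _on_)
open import Induction.WellFounded using (Acc; acc)
open import Relation.Binary.Construct.On using (wellFounded)
open import Relation.Nullary using (yes; no)
open import Relation.Nullary.Decidable using (_×-dec_; _→-dec_; ¬?)
open import Relation.Unary using (Pred; Decidable)
open import Relation.Binary.PropositionalEquality
  using (_≡_; _≢_; refl; sym; trans; cong; subst)

minimum≤ : ∀ {v} (xs : List ℕ) → v ∈ˡ xs → minimum xs ≤ v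
minimum≤ (x ∷ xs) v∈ = foldr-preservesᵒ
  (λ a b → [ m≤n⇒m⊓o≤n b , m≤n⇒o⊓m≤n a ]′) x xs (bound v∈)
  where
  bound : ∀ {v} → v ∈ˡ x ∷ xs → x ≤ v ⊎ Any.Any (_≤ v) xs
  bound (here refl) = inj₁ ≤-refl
  bound (there v∈xs) = inj₂ (Any.map (≤-reflexive ∘ sym) v∈xs)

≤maximum : ∀ {v} (xs : List ℕ) → v ∈ˡ xs → v ≤ maximum xs
≤maximum xs v∈ = foldr-preservesᵒ
  (λ a b → [ m≤n⇒m≤n⊔o b , m≤n⇒m≤o⊔n a ]′) 0 xs (inj₂ (Any.map ≤-reflexive v∈))

∈-distinctPairs : ∀ {n} {x y : Fin n} {xs} → x ∈ˡ xs → y ∈ˡ xs → x ≢ y →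
                  (x , y) ∈ˡ distinctPairs xs
∈-distinctPairs {x = x} {xs = xs} x∈ y∈ x≢y = ∈-concatMap⁺ pairsWith (Any.map pairs-of x∈)
  where
  pairsWith : Fin _ → List (Fin _ × Fin _)
  pairsWith x′ = map (x′ ,_) (filter (¬? ∘ (x′ ≟ᶠ_)) xs)
  pairs-of : ∀ {x′} → x ≡ x′ → (x , _) ∈ˡ pairsWith x′
  pairs-of refl = ∈-map⁺ (x ,_) (∈-filter⁺ (¬? ∘ (x ≟ᶠ_)) y∈ x≢y)

∣p∪q∣≤∣p∣+∣q∣ : ∀ {n} (p q : Subset n) → ∣ p ∪ q ∣ ≤ ∣ p ∣ + ∣ q ∣
∣p∪q∣≤∣p∣+∣q∣ [] [] = z≤n
∣p∪q∣≤∣p∣+∣q∣ (inside ∷ p) (t ∷ q) =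
  s≤s (≤-trans (∣p∪q∣≤∣p∣+∣q∣ p q) (+-monoʳ-≤ ∣ p ∣ (∣p∣≤∣x∷p∣ t q)))
∣p∪q∣≤∣p∣+∣q∣ (outside ∷ p) (inside ∷ q) =
  ≤-trans (s≤s (∣p∪q∣≤∣p∣+∣q∣ p q)) (≤-reflexive (sym (+-suc ∣ p ∣ ∣ q ∣)))
∣p∪q∣≤∣p∣+∣q∣ (outside ∷ p) (outside ∷ q) = ∣p∪q∣≤∣p∣+∣q∣ p q

∈▽⁻ : ∀ {n} {x : Fin n} (p q : Subset n) → x ∈ p ▽ q → x ∉ p → x ∈ q
∈▽⁻ {x = zero}  (inside ∷ _)  (_ ∷ _) _    x∉p = ⊥-elim (x∉p here)
∈▽⁻ {x = zero}  (outside ∷ _) (_ ∷ _) here _   = here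
∈▽⁻ {x = suc _} (_ ∷ p)       (_ ∷ q) (there x∈p▽q) x∉p = there (∈▽⁻ p q x∈p▽q (x∉p ∘ there))

∃-smallest : ∀ {n ℓ} {P : Pred (Subset n) ℓ} → Decidable P → ∀ {S} → P S →
             ∃[ T ] P T × (∀ T′ → P T′ → ∣ T ∣ ≤ ∣ T′ ∣)
∃-smallest {P = P} P? {S} = go S (wellFounded ∣_∣ <-wellFounded S)
  where
  go : ∀ S → Acc (_<_ on ∣_∣) S → P S → ∃[ T ] P T × (∀ T′ → P T′ → ∣ T ∣ ≤ ∣ T′ ∣)
  go S (acc rs) pS with anySubset? (λ T → P? T ×-dec (∣ T ∣ <? ∣ S ∣))
  ... | yes (T , pT , T<S) = go T (rs T<S) pT
  ... | no ∄smaller = S , pS , λ T pT → ≮⇒≥ (λ T<S → ∄smaller (T , pT , T<S))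

n≤[n∸n/2]+[n∸n/2] : ∀ n → n ≤ (n ∸ n / 2) + (n ∸ n / 2)
n≤[n∸n/2]+[n∸n/2] n = begin
  n                             ≡⟨ m∸n+n≡m (m+n≤o⇒m≤o h h+h≤n) ⟨
  (n ∸ h) + h                   ≤⟨ +-monoʳ-≤ (n ∸ h) (m+n≤o⇒m≤o∸n h h+h≤n) ⟩
  (n ∸ h) + (n ∸ h)             ∎
  where
  open ≤-Reasoning
  h = n / 2
  h+h≤n : h + h ≤ n
  h+h≤n = subst (_≤ n) (trans (*-comm h 2) (cong (h +_) (+-identityʳ h))) (m/n*n≤m n 2)

module _ {m : ℕ} (H : Graph m) where

  adj⇒∈N : ∀ {x y} → adj H x y ≡ true → y ∈ N H x
  adj⇒∈N {x} {y} xy = lookup⇒[]= y (N H x) (trans (lookup∘tabulate (adj H x) y) xy)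

  ∈N⇒adj : ∀ {x y} → y ∈ N H x → adj H x y ≡ true
  ∈N⇒adj {x} {y} y∈ = trans (sym (lookup∘tabulate (adj H x) y)) ([]=⇒lookup y∈)

  ∈N⇒∈N : ∀ {x y} → y ∈ N H x → x ∈ N H y
  ∈N⇒∈N {x} {y} y∈ = adj⇒∈N (trans (Graph.sym H y x) (∈N⇒adj y∈))

  adj⇒≢ : ∀ {x y} → adj H x y ≡ true → x ≢ y
  adj⇒≢ {x} xy refl with trans (sym xy) (irrefl H x)
  ... | ()

  deg≤Δ : ∀ x → deg H x ≤ Δ H
  deg≤Δ x = ≤maximum (map (deg H) (allFin m)) (∈-map⁺ (deg H) (∈-allFin x))

  ∣N-x∣≤Δ∸1 : ∀ {x y} → x ∈ N H y → ∣ N H y - x ∣ ≤ Δ H ∸ 1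
  ∣N-x∣≤Δ∸1 {x} {y} x∈ = subst (∣ N H y - x ∣ ≤_) (pred[m∸n]≡m∸[1+n] (Δ H) 0)
    (suc[m]≤n⇒m≤pred[n] (<-≤-trans (x∈p⇒∣p-x∣<∣p∣ x∈) (deg≤Δ y)))

  ∈adjSep∖N[x] : ∀ {x y z} → y ∈ N H x → z ∈ adjSep H x y → z ∉ N[_] H x → z ∈ N H y - x
  ∈adjSep∖N[x] {x} {y} {z} y∈Nx z∈sep z∉N[x] = x∈p∧x≢y⇒x∈p-y z∈Ny z≢x
    where
    z∉Nx : z ∉ N H x
    z∉Nx = z∉N[x] ∘ p⊆p∪q ⁅ x ⁆
    z≢x : z ≢ x
    z≢x refl = z∉N[x] (q⊆p∪q (N H x) ⁅ x ⁆ (x∈⁅x⁆ x))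
    z∈Ny : z ∈ N H y
    z∈Ny with x∈p∪q⁻ (N H x ▽ N H y) (⁅ x ⁆ ∪ ⁅ y ⁆) z∈sep
    ... | inj₁ z∈▽ = ∈▽⁻ (N H x) (N H y) z∈▽ z∉Nx
    ... | inj₂ z∈xy with x∈p∪q⁻ ⁅ x ⁆ ⁅ y ⁆ z∈xy
    ...   | inj₁ z∈⁅x⁆ = ⊥-elim (z≢x (x∈⁅y⁆⇒x≡y x z∈⁅x⁆))
    ...   | inj₂ z∈⁅y⁆ = ⊥-elim (z∉Nx (subst (_∈ N H x) (sym (x∈⁅y⁆⇒x≡y y z∈⁅y⁆)) y∈Nx))

  adjSep∩S⊆ : ∀ {x y} S → y ∈ N H x → adjSep H x y ∩ S ⊆ (N H y - x) ∪ (S ∩ N[_] H x)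
  adjSep∩S⊆ {x} {y} S y∈Nx {z} z∈ with x∈p∩q⁻ (adjSep H x y) S z∈ | z ∈? N[_] H x
  ... | _     , z∈S | yes z∈N[x] = x∈p∪q⁺ (inj₂ (x∈p∩q⁺ (z∈S , z∈N[x])))
  ... | z∈sep , _   | no z∉N[x]  = x∈p∪q⁺ (inj₁ (∈adjSep∖N[x] y∈Nx z∈sep z∉N[x]))

  k∸b≤∣S∩N[x]∣ : ∀ {k b} S → NoIsolated H → Δ H ∸ 1 ≤ b → IsAdjGen H k S →
                 ∀ x → k ∸ b ≤ ∣ S ∩ N[_] H x ∣
  k∸b≤∣S∩N[x]∣ {k} {b} S noIsolated Δ∸1≤b gen x with noIsolated x
  ... | y , xy = m≤n+o⇒m∸n≤o k b (begin
    k                                         ≤⟨ gen x y (adj⇒≢ xy) ⟩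
    ∣ adjSep H x y ∩ S ∣                      ≤⟨ p⊆q⇒∣p∣≤∣q∣ (adjSep∩S⊆ S y∈Nx) ⟩
    ∣ (N H y - x) ∪ (S ∩ N[_] H x) ∣          ≤⟨ ∣p∪q∣≤∣p∣+∣q∣ (N H y - x) (S ∩ N[_] H x) ⟩
    ∣ N H y - x ∣ + ∣ S ∩ N[_] H x ∣          ≤⟨ +-monoˡ-≤ _ (≤-trans (∣N-x∣≤Δ∸1 (∈N⇒∈N y∈Nx)) Δ∸1≤b) ⟩
    b + ∣ S ∩ N[_] H x ∣                      ∎)
    where
    open ≤-Reasoning
    y∈Nx : y ∈ N H x
    y∈Nx = adj⇒∈N xy

  isAdjGen? : ∀ k → Decidable (IsAdjGen H k)
  isAdjGen? k S = all? λ x → all? λ y → ¬? (x ≟ᶠ y) →-dec (k ≤? ∣ adjSep H x y ∩ S ∣)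

  k≤𝒞⇒⊤-isAdjGen : ∀ {k} → k ≤ 𝒞 H → IsAdjGen H k ⊤
  k≤𝒞⇒⊤-isAdjGen {k} k≤𝒞 x y x≢y =
    subst (k ≤_) (cong ∣_∣ (sym (∩-identityʳ (adjSep H x y))))
      (≤-trans k≤𝒞 (minimum≤ _ (∈-map⁺ _ (∈-distinctPairs (∈-allFin x) (∈-allFin y) x≢y))))

  adjBasis-exists : ∀ {k} → k ≤ 𝒞 H → ∃ (IsAdjBasis H k)
  adjBasis-exists {k} k≤𝒞 = ∃-smallest (isAdjGen? k) (k≤𝒞⇒⊤-isAdjGen k≤𝒞)

lemma16 : (n : ℕ) (G : Graph n) (ord : Fin n → ℕ) (H : (i : Fin n) → Graph (ord i)) (k : ℕ) →
          2 ≤ n → Connected G → (∀ i → NoIsolated (H i)) →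
          1 ≤ k → k ≤ 𝒯 G ord H ⊓ 𝒞fam G ord H →
          (∀ i → Δ (H i) ∸ 1 ≤ k / 2) →
          Property𝒫₂ G ord H k
lemma16 n G ord H k _ _ noIsolated _ k≤𝒯⊓𝒞 Δ∸1≤k/2 u _ = A , (λ i _ → proj₂ (basis i)) , sumBound
  where
  basis : ∀ i → ∃ (IsAdjBasis (H i) k)
  basis i = adjBasis-exists (H i)
    (≤-trans (m≤n⊓o⇒m≤o _ _ k≤𝒯⊓𝒞) (minimum≤ _ (∈-map⁺ (λ i → 𝒞 (H i)) (∈-allFin i))))

  A : (i : Fin n) → Subset (ord i)
  A i = proj₁ (basis i)

  halfBound : ∀ i x → k ∸ k / 2 ≤ ∣ A i ∩ N[_] (H i) x ∣
  halfBound i x = k∸b≤∣S∩N[x]∣ (H i) (A i) (noIsolated i) (Δ∸1≤k/2 i) (proj₁ (proj₂ (basis i))) x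

  sumBound : ∀ j l → N G j ≡ N G u → N G l ≡ N G u → j ≢ l →
             ∀ (x : Fin (ord j)) (y : Fin (ord l)) →
             k ≤ ∣ A j ∩ N[_] (H j) x ∣ + ∣ A l ∩ N[_] (H l) y ∣
  sumBound j l _ _ _ x y = ≤-trans (n≤[n∸n/2]+[n∸n/2] k) (+-mono-≤ (halfBound j x) (halfBound l y))
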